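{- For an integer $m\ge1$, let $p_m(x)=x^3-(m+6)x^2+(4m+9)x-(m+4)$. Then $p_m(x)$ is reducible over $\mathbb{Z}$ if and only if $m=2$. -}

module Defs where

open import Data.Nat using (ℕ; zero; suc)
open import Data.Integer using (ℤ; +_; -_; _+_; _*_; 0ℤ; 1ℤ)
open import Data.List using (List; []; _∷_; map)
open import Data.Product using (∃₂; _×_; ∃)
open import Relation.Binary.PropositionalEquality using (_≡_)
open import Relation.Nullary using (¬_)

-- Polynomials over ℤ as coefficient lists, lowest degree first
-- (a₀ ∷ a₁ ∷ … represents a₀ + a₁ x + …). Trailing zeros allowed.
Poly : Set
Poly = List ℤ

coeff : Poly → ℕ → ℤ
coeff []       _       = 0ℤ
coeff (a ∷ p) zero    = a
coeff (a ∷ p) (suc n) = coeff p n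

_≈ₚ_ : Poly → Poly → Set
p ≈ₚ q = ∀ n → coeff p n ≡ coeff q n

_+ₚ_ : Poly → Poly → Poly
[]      +ₚ q       = q
(a ∷ p) +ₚ []      = a ∷ p
(a ∷ p) +ₚ (b ∷ q) = (a + b) ∷ (p +ₚ q)

_*ₚ_ : Poly → Poly → Poly
[]      *ₚ q = []
(a ∷ p) *ₚ q = map (a *_) q +ₚ (0ℤ ∷ (p *ₚ q))

oneₚ : Poly
oneₚ = 1ℤ ∷ []

IsUnit : Poly → Set
IsUnit f = ∃ λ h → (f *ₚ h) ≈ₚ oneₚ

IsZero : Poly → Set
IsZero p = p ≈ₚ []

Reducible : Poly → Set
Reducible p = ¬ IsZero p × ¬ IsUnit p ×
  ∃₂ λ f g → ¬ IsUnit f × ¬ IsUnit g × p ≈ₚ (f *ₚ g)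

pm : ℤ → Poly
pm m = (- (m + + 4)) ∷ ((+ 4) * m + + 9) ∷ (- (m + + 6)) ∷ 1ℤ ∷ []

-- Substituting s = x − 2 gives p_m(x) = (s² − 3)(s − m) − 2. A monic cubic that splits
-- into two non-units has a linear factor with leading coefficient ±1, hence an integer
-- root x; then s² − 3 divides 2, which forces s ∈ {±1, ±2}, and among the resulting
-- values m ∈ {2, 0, −4} only m = 2 is positive. Conversely
-- p₂(x) = (x − 3)(x² − 5x + 2).
module Submission where

open import Data.Empty using (⊥-elim)
open import Data.Integer
  using (ℤ; +_; -_; _+_; _≟_; _-_; _*_; _≤_; +≤+; 0ℤ; 1ℤ; -1ℤ; ∣_∣; NonZero; +0; +[1+_]; -[1+_])
open import Data.Integer.Properties
  using (+-identityˡ; +-identityʳ; *-zeroˡ; *-zeroʳ; *-comm; abs-*; *-cancelˡ-≡; i*j≡0⇒i≡0∨j≡0; i-j≡0⇒i≡j)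
open import Data.Integer.Tactic.RingSolver using (solve-∀)
open import Data.List using (List; []; _∷_; map; length)
open import Data.Nat using (ℕ; zero; suc; z≤n; s≤s)
import Data.Nat as ℕ
import Data.Nat.Properties as ℕ
open import Data.Nat.Divisibility using (_∣_; m∣m*n; ∣⇒≤)
open import Data.Product using (∃; _×_; _,_)
open import Data.Sum using (_⊎_; inj₁; inj₂)
open import Function.Base using (case_of_)
open import Function.Bundles using (_⇔_; mk⇔)
open import Relation.Binary.Definitions using (tri<; tri≈; tri>)
open import Relation.Binary.PropositionalEquality
open import Relation.Nullary using (¬_; yes; no)

open import Defs

coeff-+ₚ : ∀ p q n → coeff (p +ₚ q) n ≡ coeff p n + coeff q n
coeff-+ₚ []      q       n       = sym (+-identityˡ _)
coeff-+ₚ (a ∷ p) []      n       = sym (+-identityʳ _)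
coeff-+ₚ (a ∷ p) (b ∷ q) zero    = refl
coeff-+ₚ (a ∷ p) (b ∷ q) (suc n) = coeff-+ₚ p q n

coeff-map-* : ∀ a q n → coeff (map (a *_) q) n ≡ a * coeff q n
coeff-map-* a []      n       = sym (*-zeroʳ a)
coeff-map-* a (b ∷ q) zero    = refl
coeff-map-* a (b ∷ q) (suc n) = coeff-map-* a q n

coeff-∷-*ₚ-zero : ∀ a p q → coeff ((a ∷ p) *ₚ q) 0 ≡ a * coeff q 0
coeff-∷-*ₚ-zero a p q = trans (coeff-+ₚ (map (a *_) q) _ 0)
  (trans (+-identityʳ _) (coeff-map-* a q 0))

coeff-∷-*ₚ-suc : ∀ a p q n →
                 coeff ((a ∷ p) *ₚ q) (suc n) ≡ a * coeff q (suc n) + coeff (p *ₚ q) n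
coeff-∷-*ₚ-suc a p q n = trans (coeff-+ₚ (map (a *_) q) _ (suc n))
  (cong (_+ coeff (p *ₚ q) n) (coeff-map-* a q (suc n)))

*ₚ-zeroˡ : ∀ p q → IsZero p → IsZero (p *ₚ q)
*ₚ-zeroˡ []      q z n       = refl
*ₚ-zeroˡ (a ∷ p) q z zero    rewrite coeff-∷-*ₚ-zero a p q | z 0 = *-zeroˡ (coeff q 0)
*ₚ-zeroˡ (a ∷ p) q z (suc n) rewrite coeff-∷-*ₚ-suc a p q n | z 0
                                   | *ₚ-zeroˡ p q (λ k → z (suc k)) n
  = trans (+-identityʳ _) (*-zeroˡ (coeff q (suc n)))

*ₚ-zeroʳ : ∀ p q → IsZero q → IsZero (p *ₚ q)
*ₚ-zeroʳ []      q z n       = refl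
*ₚ-zeroʳ (a ∷ p) q z zero    rewrite coeff-∷-*ₚ-zero a p q | z 0 = *-zeroʳ a
*ₚ-zeroʳ (a ∷ p) q z (suc n) rewrite coeff-∷-*ₚ-suc a p q n | z (suc n)
                                   | *ₚ-zeroʳ p q z n | *-zeroʳ a = refl

coeff-∷-*ₚ-const : ∀ a p q n → IsZero p → coeff ((a ∷ p) *ₚ q) n ≡ a * coeff q n
coeff-∷-*ₚ-const a p q zero    z = coeff-∷-*ₚ-zero a p q
coeff-∷-*ₚ-const a p q (suc n) z rewrite coeff-∷-*ₚ-suc a p q n
                                       | *ₚ-zeroˡ p q z n = +-identityʳ _

Degree≤ : ℕ → Poly → Set
Degree≤ d p = ∀ n → d ℕ.< n → coeff p n ≡ 0ℤ

Degree : ℕ → Poly → Set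
Degree d p = Degree≤ d p × coeff p d ≢ 0ℤ

coeff-beyond-length : ∀ p n → length p ℕ.≤ n → coeff p n ≡ 0ℤ
coeff-beyond-length []      n       _         = refl
coeff-beyond-length (a ∷ p) (suc n) (s≤s l≤n) = coeff-beyond-length p n l≤n

length≤⇒degree≤ : ∀ {d} p → length p ℕ.≤ suc d → Degree≤ d p
length≤⇒degree≤ p l≤1+d n d<n = coeff-beyond-length p n (ℕ.≤-trans l≤1+d d<n)

degree≤-∷ : ∀ {d} a p → Degree≤ (suc d) (a ∷ p) → Degree≤ d p
degree≤-∷ a p bound n d<n = bound (suc n) (s≤s d<n)

degree≤0-∷ : ∀ a p → Degree≤ 0 (a ∷ p) → IsZero p
degree≤0-∷ a p bound n = bound (suc n) (s≤s z≤n)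

degree-or-zero : ∀ p → IsZero p ⊎ ∃ λ d → Degree d p
degree-or-zero [] = inj₁ (λ _ → refl)
degree-or-zero (a ∷ p) with degree-or-zero p
... | inj₂ (d , bound , lc≢0) = inj₂ (suc d , shifted , lc≢0)
  where
  shifted : Degree≤ (suc d) (a ∷ p)
  shifted (suc n) (s≤s d<n) = bound n d<n
... | inj₁ z with a ≟ 0ℤ
...   | yes refl = inj₁ λ { zero → refl ; (suc n) → z n }
...   | no a≢0   = inj₂ (0 , (λ { (suc n) _ → z n }) , a≢0)

*ₚ-degree≤ : ∀ {d e} p q → Degree≤ d p → Degree≤ e q → Degree≤ (d ℕ.+ e) (p *ₚ q)
*ₚ-degree≤ []      q bp bq n _ = refl
*ₚ-degree≤ {zero} (a ∷ p) q bp bq n e<n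
  rewrite coeff-∷-*ₚ-const a p q n (degree≤0-∷ a p bp) | bq n e<n = *-zeroʳ a
*ₚ-degree≤ {suc d} {e} (a ∷ p) q bp bq (suc n) (s≤s d+e<n)
  = begin
    coeff ((a ∷ p) *ₚ q) (suc n)       ≡⟨ coeff-∷-*ₚ-suc a p q n ⟩
    a * coeff q (suc n) + coeff (p *ₚ q) n
      ≡⟨ cong₂ (λ u v → a * u + v) (bq (suc n) e<1+n) (*ₚ-degree≤ p q (degree≤-∷ a p bp) bq n d+e<n) ⟩
    a * 0ℤ + 0ℤ                        ≡⟨ +-identityʳ _ ⟩
    a * 0ℤ                             ≡⟨ *-zeroʳ a ⟩
    0ℤ                                 ∎
  where
  open ≡-Reasoning
  e<1+n : e ℕ.< suc n
  e<1+n = s≤s (ℕ.≤-trans (ℕ.m≤n+m e d) (ℕ.<⇒≤ d+e<n))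

coeff-*ₚ-top : ∀ {d e} p q → Degree≤ d p → Degree≤ e q →
               coeff (p *ₚ q) (d ℕ.+ e) ≡ coeff p d * coeff q e
coeff-*ₚ-top {e = e} []      q bp bq = sym (*-zeroˡ (coeff q e))
coeff-*ₚ-top {zero} {e} (a ∷ p) q bp bq = coeff-∷-*ₚ-const a p q e (degree≤0-∷ a p bp)
coeff-*ₚ-top {suc d} {e} (a ∷ p) q bp bq
  rewrite coeff-∷-*ₚ-suc a p q (d ℕ.+ e)
        | bq (suc (d ℕ.+ e)) (s≤s (ℕ.m≤n+m e d)) | *-zeroʳ a
  = trans (+-identityˡ _) (coeff-*ₚ-top p q (degree≤-∷ a p bp) bq)

monic-factor-degrees : ∀ {n d e} p f g → Degree≤ n p → coeff p n ≡ 1ℤ →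
                       p ≈ₚ (f *ₚ g) → Degree d f → Degree e g →
                       d ℕ.+ e ≡ n × coeff f d * coeff g e ≡ 1ℤ
monic-factor-degrees {n} {d} {e} p f g bp monic p≈fg (bf , lcf≢0) (bg , lcg≢0)
  with ℕ.<-cmp (d ℕ.+ e) n
... | tri< d+e<n _ _ with trans (sym monic) (trans (p≈fg n) (*ₚ-degree≤ f g bf bg n d+e<n))
...   | ()
monic-factor-degrees {n} {d} {e} p f g bp monic p≈fg (bf , lcf≢0) (bg , lcg≢0)
  | tri> _ _ n<d+e with i*j≡0⇒i≡0∨j≡0 (coeff f d)
    (trans (sym (coeff-*ₚ-top f g bf bg)) (trans (sym (p≈fg (d ℕ.+ e))) (bp _ n<d+e)))
...   | inj₁ lcf≡0 = ⊥-elim (lcf≢0 lcf≡0)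
...   | inj₂ lcg≡0 = ⊥-elim (lcg≢0 lcg≡0)
monic-factor-degrees p f g bp monic p≈fg (bf , _) (bg , _) | tri≈ _ refl _ =
  refl , trans (sym (coeff-*ₚ-top f g bf bg)) (trans (sym (p≈fg _)) monic)

IsSign : ℤ → Set
IsSign a = a ≡ 1ℤ ⊎ a ≡ -1ℤ

i*j≡1⇒sign : ∀ i j → i * j ≡ 1ℤ → IsSign i
i*j≡1⇒sign i j eq with ℕ.m*n≡1⇒m≡1 ∣ i ∣ ∣ j ∣ (trans (sym (abs-* i j)) (cong ∣_∣ eq))
i*j≡1⇒sign (+ 1)    j eq | refl = inj₁ refl
i*j≡1⇒sign -[1+ 0 ] j eq | refl = inj₂ refl

degree≤0-unit : ∀ f → Degree≤ 0 f → IsSign (coeff f 0) → IsUnit f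
degree≤0-unit []      _     (inj₁ ())
degree≤0-unit []      _     (inj₂ ())
degree≤0-unit (a ∷ f) bound sign = (a ∷ []) , λ n →
  trans (coeff-∷-*ₚ-const a f (a ∷ []) n (degree≤0-∷ a f bound)) (a*[a]≈1 sign n)
  where
  a*[a]≈1 : IsSign a → ∀ n → a * coeff (a ∷ []) n ≡ coeff oneₚ n
  a*[a]≈1 _          (suc n) = *-zeroʳ a
  a*[a]≈1 (inj₁ refl) zero   = refl
  a*[a]≈1 (inj₂ refl) zero   = refl

positive-degree⇒non-unit : ∀ {d} f → Degree (suc d) f → ¬ IsUnit f
positive-degree⇒non-unit {d} f (bf , lcf≢0) (h , fh≈1) with degree-or-zero h
... | inj₁ h≈0 with trans (sym (fh≈1 0)) (*ₚ-zeroʳ f h h≈0 0)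
...   | ()
positive-degree⇒non-unit {d} f (bf , lcf≢0) (h , fh≈1) | inj₂ (e , bh , lch≢0)
  with i*j≡0⇒i≡0∨j≡0 (coeff f (suc d)) (trans (sym (coeff-*ₚ-top f h bf bh)) (fh≈1 (suc (d ℕ.+ e))))
... | inj₁ lcf≡0 = lcf≢0 lcf≡0
... | inj₂ lch≡0 = lch≢0 lch≡0

eval : Poly → ℤ → ℤ
eval []      x = 0ℤ
eval (a ∷ p) x = a + x * eval p x

eval-+ₚ : ∀ p q x → eval (p +ₚ q) x ≡ eval p x + eval q x
eval-+ₚ []      q       x = sym (+-identityˡ _)
eval-+ₚ (a ∷ p) []      x = sym (+-identityʳ _)
eval-+ₚ (a ∷ p) (b ∷ q) x rewrite eval-+ₚ p q x = ring a b x (eval p x) (eval q x)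
  where
  ring : ∀ a b x u v → a + b + x * (u + v) ≡ a + x * u + (b + x * v)
  ring = solve-∀

eval-map-* : ∀ a q x → eval (map (a *_) q) x ≡ a * eval q x
eval-map-* a []      x = sym (*-zeroʳ a)
eval-map-* a (b ∷ q) x rewrite eval-map-* a q x = ring a b x (eval q x)
  where
  ring : ∀ a b x u → a * b + x * (a * u) ≡ a * (b + x * u)
  ring = solve-∀

eval-*ₚ : ∀ p q x → eval (p *ₚ q) x ≡ eval p x * eval q x
eval-*ₚ []      q x = refl
eval-*ₚ (a ∷ p) q x
  rewrite eval-+ₚ (map (a *_) q) (0ℤ ∷ (p *ₚ q)) x | eval-map-* a q x | eval-*ₚ p q x
  = ring a x (eval p x) (eval q x)
  where
  ring : ∀ a x u v → a * v + (0ℤ + x * (u * v)) ≡ (a + x * u) * v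
  ring = solve-∀

eval-zero : ∀ p x → IsZero p → eval p x ≡ 0ℤ
eval-zero []      x z = refl
eval-zero (a ∷ p) x z rewrite z 0 | eval-zero p x (λ k → z (suc k)) | *-zeroʳ x = refl

eval-cong : ∀ p q x → p ≈ₚ q → eval p x ≡ eval q x
eval-cong []      []      x e = refl
eval-cong (a ∷ p) []      x e = eval-zero (a ∷ p) x e
eval-cong []      (a ∷ q) x e = sym (eval-zero (a ∷ q) x (λ k → sym (e k)))
eval-cong (a ∷ p) (b ∷ q) x e rewrite e 0 | eval-cong p q x (λ k → e (suc k)) = refl

HasRoot : Poly → Set
HasRoot p = ∃ λ r → eval p r ≡ 0ℤ

sign-linear-root : ∀ a {c} → IsSign c → HasRoot (a ∷ c ∷ [])
sign-linear-root a (inj₁ refl) = - a , ring a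
  where
  ring : ∀ a → a + (- a) * (1ℤ + (- a) * 0ℤ) ≡ 0ℤ
  ring = solve-∀
sign-linear-root a (inj₂ refl) = a , ring a
  where
  ring : ∀ a → a + a * (-1ℤ + a * 0ℤ) ≡ 0ℤ
  ring = solve-∀

degree≤1-root : ∀ f → Degree≤ 1 f → IsSign (coeff f 1) → HasRoot f
degree≤1-root f bound sign with sign-linear-root (coeff f 0) sign
... | r , root = r , trans (eval-cong f _ r f≈linear) root
  where
  f≈linear : f ≈ₚ (coeff f 0 ∷ coeff f 1 ∷ [])
  f≈linear zero          = refl
  f≈linear (suc zero)    = refl
  f≈linear (suc (suc n)) = bound (suc (suc n)) (s≤s (s≤s z≤n))

factor-root : ∀ p f g x → p ≈ₚ (f *ₚ g) → eval f x ≡ 0ℤ ⊎ eval g x ≡ 0ℤ → eval p x ≡ 0ℤ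
factor-root p f g x p≈fg root =
  trans (eval-cong p (f *ₚ g) x p≈fg) (trans (eval-*ₚ f g x) (zero-factor root))
  where
  zero-factor : eval f x ≡ 0ℤ ⊎ eval g x ≡ 0ℤ → eval f x * eval g x ≡ 0ℤ
  zero-factor (inj₁ f≡0) rewrite f≡0 = refl
  zero-factor (inj₂ g≡0) rewrite g≡0 = *-zeroʳ (eval f x)

degree-3-factorisation⇒root : ∀ p f g d e → p ≈ₚ (f *ₚ g) → ¬ IsUnit f → ¬ IsUnit g →
                              Degree≤ d f → Degree≤ e g → IsSign (coeff f d) → IsSign (coeff g e) →
                              d ℕ.+ e ≡ 3 → HasRoot p
degree-3-factorisation⇒root p f g 0 _ _ f∉units _ bf _ sf _ _ =
  ⊥-elim (f∉units (degree≤0-unit f bf sf))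
degree-3-factorisation⇒root p f g 1 2 p≈fg _ _ bf _ sf _ refl with degree≤1-root f bf sf
... | r , root = r , factor-root p f g r p≈fg (inj₁ root)
degree-3-factorisation⇒root p f g 2 1 p≈fg _ _ _ bg _ sg refl with degree≤1-root g bg sg
... | r , root = r , factor-root p f g r p≈fg (inj₂ root)
degree-3-factorisation⇒root p f g 3 0 _ _ g∉units _ bg _ sg refl =
  ⊥-elim (g∉units (degree≤0-unit g bg sg))
degree-3-factorisation⇒root p f g (suc (suc (suc (suc d)))) e _ _ _ _ _ _ _ ()

monic-cubic-factorisation⇒root : ∀ p f g → Degree≤ 3 p → coeff p 3 ≡ 1ℤ →
                                  ¬ IsUnit f → ¬ IsUnit g → p ≈ₚ (f *ₚ g) → HasRoot p
monic-cubic-factorisation⇒root p f g bp monic f∉units g∉units p≈fg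
  with degree-or-zero f | degree-or-zero g
... | inj₁ f≈0 | _ with trans (sym monic) (trans (p≈fg 3) (*ₚ-zeroˡ f g f≈0 3))
...   | ()
monic-cubic-factorisation⇒root p f g bp monic f∉units g∉units p≈fg
  | inj₂ _ | inj₁ g≈0 with trans (sym monic) (trans (p≈fg 3) (*ₚ-zeroʳ f g g≈0 3))
...   | ()
monic-cubic-factorisation⇒root p f g bp monic f∉units g∉units p≈fg
  | inj₂ (d , degf@(bf , _)) | inj₂ (e , degg@(bg , _))
  with monic-factor-degrees p f g bp monic p≈fg degf degg
... | d+e≡3 , lcf*lcg≡1 =
  degree-3-factorisation⇒root p f g d e p≈fg f∉units g∉units bf bg
    (i*j≡1⇒sign (coeff f d) (coeff g e) lcf*lcg≡1)
    (i*j≡1⇒sign (coeff g e) (coeff f d) (trans (*-comm (coeff g e) (coeff f d)) lcf*lcg≡1)) d+e≡3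

∣i∣≤2-of-i*j≡2 : ∀ i j → i * j ≡ + 2 → ∣ i ∣ ℕ.≤ 2
∣i∣≤2-of-i*j≡2 i j eq =
  ∣⇒≤ (subst (λ n → ∣ i ∣ ∣ n) (trans (sym (abs-* i j)) (cong ∣_∣ eq)) (m∣m*n ∣ j ∣))

m≡s-k : ∀ q k s m .{{_ : NonZero q}} → q * (s - m) ≡ q * k → m ≡ s - k
m≡s-k q k s m eq = trans (sym (ring s m)) (cong (_-_ s) (*-cancelˡ-≡ q (s - m) k eq))
  where
  ring : ∀ s m → s - (s - m) ≡ m
  ring = solve-∀

shifted-root⇒m≡2 : ∀ s m → + 1 ≤ m → (s * s - + 3) * (s - m) ≡ + 2 → m ≡ + 2
shifted-root⇒m≡2 s m 1≤m eq = by-cases s 1≤m (∣i∣≤2-of-i*j≡2 (s * s - + 3) (s - m) eq) eq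
  where
  3≤∣[3+n]²-3∣ : ∀ n → 3 ℕ.≤ ∣ +[1+ suc (suc n) ] * +[1+ suc (suc n) ] - + 3 ∣
  3≤∣[3+n]²-3∣ n = ℕ.≤-trans (s≤s (s≤s (s≤s z≤n))) (ℕ.m≤n+m _ n)
  by-cases : ∀ s → + 1 ≤ m → ∣ s * s - + 3 ∣ ℕ.≤ 2 → (s * s - + 3) * (s - m) ≡ + 2 → m ≡ + 2
  -- For s ∈ {±1, ±2} the equation reads q (s − m) = q k with q = s² − 3 and q k = 2.
  by-cases +0 _ (s≤s (s≤s ())) _
  by-cases (+ 1) _ _ eq = m≡s-k -[1+ 1 ] -1ℤ (+ 1) m eq
  by-cases (+ 2) 1≤m _ eq with m≡s-k 1ℤ (+ 2) (+ 2) m eq | 1≤m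
  ... | refl | +≤+ ()
  by-cases -[1+ 0 ] 1≤m _ eq with m≡s-k -[1+ 1 ] -1ℤ -1ℤ m eq | 1≤m
  ... | refl | +≤+ ()
  by-cases -[1+ 1 ] 1≤m _ eq with m≡s-k 1ℤ (+ 2) -[1+ 1 ] m eq | 1≤m
  ... | refl | ()
  by-cases +[1+ suc (suc n) ] _ ≤2 _ = ⊥-elim (ℕ.<⇒≱ (3≤∣[3+n]²-3∣ n) ≤2)
  by-cases -[1+ suc (suc n) ] _ ≤2 _ = ⊥-elim (ℕ.<⇒≱ (3≤∣[3+n]²-3∣ n) ≤2)

eval-pm : ∀ m x → eval (pm m) x ≡ ((x - + 2) * (x - + 2) - + 3) * ((x - + 2) - m) - + 2
eval-pm = ring
  where
  ring : ∀ m x → - (m + + 4) + x * ((+ 4 * m + + 9) + x * (- (m + + 6) + x * (1ℤ + x * 0ℤ)))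
                 ≡ ((x - + 2) * (x - + 2) - + 3) * ((x - + 2) - m) - + 2
  ring = solve-∀

pm-root⇒m≡2 : ∀ m → + 1 ≤ m → HasRoot (pm m) → m ≡ + 2
pm-root⇒m≡2 m 1≤m (x , root) =
  shifted-root⇒m≡2 (x - + 2) m 1≤m (i-j≡0⇒i≡j _ (+ 2) (trans (sym (eval-pm m x)) root))

pm-reducible⇒root : ∀ m → Reducible (pm m) → HasRoot (pm m)
pm-reducible⇒root m (_ , _ , f , g , f∉units , g∉units , pm≈fg) =
  monic-cubic-factorisation⇒root (pm m) f g (length≤⇒degree≤ (pm m) ℕ.≤-refl) refl
    f∉units g∉units pm≈fg

pm-2-reducible : Reducible (pm (+ 2))
pm-2-reducible =
    (λ pm≈0 → case pm≈0 3 of λ ())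
  , positive-degree⇒non-unit (pm (+ 2)) (exact-degree (pm (+ 2)) refl (λ ()))
  , x-3 , x²-5x+2
  , positive-degree⇒non-unit x-3 (exact-degree x-3 refl (λ ()))
  , positive-degree⇒non-unit x²-5x+2 (exact-degree x²-5x+2 refl (λ ()))
  , λ n → refl
  where
  x-3 x²-5x+2 : Poly
  x-3      = -[1+ 2 ] ∷ 1ℤ ∷ []
  x²-5x+2 = + 2 ∷ -[1+ 4 ] ∷ 1ℤ ∷ []
  exact-degree : ∀ {d} p → length p ≡ suc d → coeff p d ≢ 0ℤ → Degree d p
  exact-degree p l≡1+d lc≢0 = length≤⇒degree≤ p (ℕ.≤-reflexive l≡1+d) , lc≢0

lemma4p5 : (m : ℤ) → + 1 ≤ m → (Reducible (pm m) ⇔ m ≡ + 2)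
lemma4p5 m 1≤m = mk⇔ (λ reducible → pm-root⇒m≡2 m 1≤m (pm-reducible⇒root m reducible))
                     (λ { refl → pm-2-reducible })
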